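{- Let $\phi(x)$ be an IPC formula positive and weakly negative in $x$, decomposed as $\phi(x) = \psi_{0}(\psi_{1}(x), \ldots ,\psi_{n}(x))$ where all variables $y_{1},\ldots,y_{n}$ are negative in $\psi_{0}(y_{1},\ldots,y_{n})$ and $x$ is negative in each $\psi_{i}(x)$, $i=1,\ldots,n$. Then $\phi(x)$ converges to its least fixed point in at most $n + 1$ steps, i.e. $\mu_{x}.\phi(x) = \phi^{n+1}(\bot)$ in every Heyting algebra under every valuation.
   Context: Formulas are IPC formulas built with $\top,\bot,\land,\vee,\to$, interpreted in Heyting algebras. An occurrence of $x$ is positive (negative) if the path to it from the root of the syntax tree enters the left argument of an implication an even (odd) number of times. An occurrence of $x$ is weakly negative in $\phi$ if it lies in the left argument $\psi_{0}$ of some subformula $\psi_{0} \to \psi_{1}$; $\phi$ is weakly negative in $x$ if every occurrence of $x$ is weakly negative. $\phi^{k}(\bot)$ is the $k$-fold iterate of the induced monotone function applied to $\bot$. -}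

module Defs where

open import Level using (Level)
open import Data.Nat using (ℕ; zero; suc)
open import Data.Fin using (Fin)
open import Data.Maybe using (Maybe; just; nothing)
open import Data.Sum using (_⊎_; inj₁; inj₂)
open import Data.Product using (_×_; ∃)
open import Data.Unit using () renaming (⊤ to Unit)
open import Relation.Nullary using (¬_)
open import Relation.Binary.PropositionalEquality using (_≡_)
open import Relation.Binary.Lattice.Bundles using (HeytingAlgebra)

infixr 5 _⇒_
infixr 6 _∨ᶠ_
infixr 7 _∧ᶠ_
data Fm (V : Set) : Set where
  var  : V → Fm V
  ⊤ᶠ   : Fm V
  ⊥ᶠ   : Fm V
  _∧ᶠ_ : Fm V → Fm V → Fm V
  _∨ᶠ_ : Fm V → Fm V → Fm V
  _⇒_  : Fm V → Fm V → Fm V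

-- T selects the tracked variable(s).
mutual
  AllPos : {V : Set} → (V → Set) → Fm V → Set
  AllPos T (var v)  = Unit
  AllPos T ⊤ᶠ       = Unit
  AllPos T ⊥ᶠ       = Unit
  AllPos T (a ∧ᶠ b) = AllPos T a × AllPos T b
  AllPos T (a ∨ᶠ b) = AllPos T a × AllPos T b
  AllPos T (a ⇒ b)  = AllNeg T a × AllPos T b

  AllNeg : {V : Set} → (V → Set) → Fm V → Set
  AllNeg T (var v)  = ¬ T v
  AllNeg T ⊤ᶠ       = Unit
  AllNeg T ⊥ᶠ       = Unit
  AllNeg T (a ∧ᶠ b) = AllNeg T a × AllNeg T b
  AllNeg T (a ∨ᶠ b) = AllNeg T a × AllNeg T b
  AllNeg T (a ⇒ b)  = AllPos T a × AllNeg T b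

WeaklyNeg : {V : Set} → (V → Set) → Fm V → Set
WeaklyNeg T (var v)  = ¬ T v
WeaklyNeg T ⊤ᶠ       = Unit
WeaklyNeg T ⊥ᶠ       = Unit
WeaklyNeg T (a ∧ᶠ b) = WeaklyNeg T a × WeaklyNeg T b
WeaklyNeg T (a ∨ᶠ b) = WeaklyNeg T a × WeaklyNeg T b
WeaklyNeg T (a ⇒ b)  = WeaklyNeg T b

-- Formulas in the distinguished variable x (= nothing) and parameters P
IsX : {P : Set} → Maybe P → Set
IsX v = v ≡ nothing

IsY : {n : ℕ} {P : Set} → Fin n ⊎ P → Set
IsY {n} v = ∃ λ (i : Fin n) → v ≡ inj₁ i

subst : {V W : Set} → (V → Fm W) → Fm V → Fm W
subst σ (var v)  = σ v
subst σ ⊤ᶠ       = ⊤ᶠ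
subst σ ⊥ᶠ       = ⊥ᶠ
subst σ (a ∧ᶠ b) = subst σ a ∧ᶠ subst σ b
subst σ (a ∨ᶠ b) = subst σ a ∨ᶠ subst σ b
subst σ (a ⇒ b)  = subst σ a ⇒ subst σ b

compose : {n : ℕ} {P : Set} → Fm (Fin n ⊎ P) → (Fin n → Fm (Maybe P)) → Fm (Maybe P)
compose ψ₀ ψ = subst σ ψ₀
  where
  σ : _ → Fm _
  σ (inj₁ i) = ψ i
  σ (inj₂ p) = var (just p)

module _ {c ℓ₁ ℓ₂ : Level} (H : HeytingAlgebra c ℓ₁ ℓ₂) where
  open HeytingAlgebra H

  ⟦_⟧ : {V : Set} → Fm V → (V → Carrier) → Carrier
  ⟦ var v ⟧  ρ = ρ v
  ⟦ ⊤ᶠ ⟧     ρ = ⊤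
  ⟦ ⊥ᶠ ⟧     ρ = ⊥
  ⟦ a ∧ᶠ b ⟧ ρ = ⟦ a ⟧ ρ ∧ ⟦ b ⟧ ρ
  ⟦ a ∨ᶠ b ⟧ ρ = ⟦ a ⟧ ρ ∨ ⟦ b ⟧ ρ
  ⟦ a ⇒ b ⟧  ρ = ⟦ a ⟧ ρ ⇨ ⟦ b ⟧ ρ

  fun : {P : Set} → Fm (Maybe P) → (P → Carrier) → Carrier → Carrier
  fun φ ρ a = ⟦ φ ⟧ ext
    where
    ext : Maybe _ → Carrier
    ext nothing  = a
    ext (just p) = ρ p

  iter : {P : Set} → Fm (Maybe P) → (P → Carrier) → ℕ → Carrier
  iter φ ρ zero    = ⊥
  iter φ ρ (suc k) = fun φ ρ (iter φ ρ k)

  IsLeastFixedPoint : (Carrier → Carrier) → Carrier → Set (c Level.⊔ ℓ₁ Level.⊔ ℓ₂)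
  IsLeastFixedPoint f a = (f a ≈ a) × (∀ b → f b ≈ b → a ≤ b)

{-# OPTIONS --safe #-}
-- Write φ(x) = G(h₁(x),…,hₙ(x)) with G and every hᵢ antitone, so the
-- approximants aₖ = φᵏ(⊥) ascend while the hᵢ(aₖ) descend.  Polynomial maps on
-- a Heyting algebra are compatible with the congruences of its filters, so
-- wherever hᵢ(aₖ) = hᵢ(aₖ₊₁) holds below e for all i, also aₖ₊₁ = aₖ₊₂ holds
-- below e; and conversely aₖ₊₁ = aₖ₊₂ below e forces hᵢ(aₖ₊₁) = hᵢ(aₖ₊₂).
-- Strengthening e one coordinate at a time, the n coordinates are all
-- stabilised after n stages, giving aₙ₊₂ ≤ aₙ₊₁ below ⊤.
module Submission where

open import Defs hiding (⟦_⟧)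
import Defs
open import Level using (Level)
open import Data.Nat using (ℕ; zero; suc; _+_) renaming (_≤_ to _≤ℕ_)
open import Data.Nat.Properties using (+-comm; ≤-reflexive; <-≤-trans; ≤-pred; n≮0)
open import Data.Fin using (Fin; _≟_)
open import Data.Fin.Subset as Subset using (Subset; _∉_; _-_; ∣_∣)
open import Data.Fin.Subset.Properties using (_∈?_; ∈⊤; ∣⊤∣≡n; x∈p⇒∣p-x∣<∣p∣; x∈p∧x≢y⇒x∈p-y)
open import Data.Maybe using (Maybe; just; nothing; maybe′)
open import Data.Sum using (_⊎_; inj₁; inj₂; [_,_]′)
open import Data.Product using (_,_)
open import Data.Empty using (⊥-elim)
open import Relation.Nullary using (¬_; yes; no; contradiction)
open import Relation.Binary.PropositionalEquality as ≡ using (_≡_; refl; sym; trans; cong; cong₂)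
open import Relation.Binary.Lattice.Bundles using (HeytingAlgebra)

module _ {c ℓ₁ ℓ₂ : Level} (H : HeytingAlgebra c ℓ₁ ℓ₂) where
  open HeytingAlgebra H hiding (trans; refl)
  open HeytingAlgebra H using () renaming (trans to ≤-trans; refl to ≤-refl)
  open import Relation.Binary.Lattice.Properties.HeytingAlgebra H using (∧-distribˡ-∨-≤; ⇨-eval)
  open import Relation.Binary.Lattice.Properties.MeetSemilattice meetSemilattice using (∧-monotonic; ∧-assoc)
  open import Relation.Binary.Lattice.Properties.JoinSemilattice joinSemilattice using (∨-monotonic)
  open import Relation.Binary.Reasoning.PartialOrder poset

  ⟦_⟧ : {V : Set} → Fm V → (V → Carrier) → Carrier
  ⟦_⟧ = Defs.⟦_⟧ H

  ⟦⟧-cong : {V : Set} (t : Fm V) {ρ σ : V → Carrier} → (∀ v → ρ v ≡ σ v) → ⟦ t ⟧ ρ ≡ ⟦ t ⟧ σ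
  ⟦⟧-cong (var v)  ρ≗σ = ρ≗σ v
  ⟦⟧-cong ⊤ᶠ       ρ≗σ = refl
  ⟦⟧-cong ⊥ᶠ       ρ≗σ = refl
  ⟦⟧-cong (a ∧ᶠ b) ρ≗σ = cong₂ _∧_ (⟦⟧-cong a ρ≗σ) (⟦⟧-cong b ρ≗σ)
  ⟦⟧-cong (a ∨ᶠ b) ρ≗σ = cong₂ _∨_ (⟦⟧-cong a ρ≗σ) (⟦⟧-cong b ρ≗σ)
  ⟦⟧-cong (a ⇒ b)  ρ≗σ = cong₂ _⇨_ (⟦⟧-cong a ρ≗σ) (⟦⟧-cong b ρ≗σ)

  ⟦⟧-subst : {V W : Set} (σ : V → Fm W) (t : Fm V) (ρ : W → Carrier) →
    ⟦ subst σ t ⟧ ρ ≡ ⟦ t ⟧ (λ v → ⟦ σ v ⟧ ρ)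
  ⟦⟧-subst σ (var v)  ρ = refl
  ⟦⟧-subst σ ⊤ᶠ       ρ = refl
  ⟦⟧-subst σ ⊥ᶠ       ρ = refl
  ⟦⟧-subst σ (a ∧ᶠ b) ρ = cong₂ _∧_ (⟦⟧-subst σ a ρ) (⟦⟧-subst σ b ρ)
  ⟦⟧-subst σ (a ∨ᶠ b) ρ = cong₂ _∨_ (⟦⟧-subst σ a ρ) (⟦⟧-subst σ b ρ)
  ⟦⟧-subst σ (a ⇒ b)  ρ = cong₂ _⇨_ (⟦⟧-subst σ a ρ) (⟦⟧-subst σ b ρ)

  fun-maybe′ : {P : Set} (φ : Fm (Maybe P)) (ρ : P → Carrier) (x : Carrier) →
    fun H φ ρ x ≡ ⟦ φ ⟧ (maybe′ ρ x)
  fun-maybe′ φ ρ x = ⟦⟧-cong φ λ { nothing → refl ; (just p) → refl }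

  module _ {V : Set} (T : V → Set) {ρ σ : V → Carrier}
           (ρ≤σ : ∀ v → ρ v ≤ σ v) (σ≤ρ-off-T : ∀ v → ¬ T v → σ v ≤ ρ v) where

    mutual
      ⟦⟧-monotone : (t : Fm V) → AllPos T t → ⟦ t ⟧ ρ ≤ ⟦ t ⟧ σ
      ⟦⟧-monotone (var v)  _          = ρ≤σ v
      ⟦⟧-monotone ⊤ᶠ       _          = ≤-refl
      ⟦⟧-monotone ⊥ᶠ       _          = ≤-refl
      ⟦⟧-monotone (a ∧ᶠ b) (pa , pb)  = ∧-monotonic (⟦⟧-monotone a pa) (⟦⟧-monotone b pb)
      ⟦⟧-monotone (a ∨ᶠ b) (pa , pb)  = ∨-monotonic (⟦⟧-monotone a pa) (⟦⟧-monotone b pb)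
      ⟦⟧-monotone (a ⇒ b)  (na , pb)  =
        transpose-⇨ (≤-trans (∧-monotonic ≤-refl (⟦⟧-antitone a na))
                             (≤-trans (transpose-∧ ≤-refl) (⟦⟧-monotone b pb)))

      ⟦⟧-antitone : (t : Fm V) → AllNeg T t → ⟦ t ⟧ σ ≤ ⟦ t ⟧ ρ
      ⟦⟧-antitone (var v)  ¬Tv        = σ≤ρ-off-T v ¬Tv
      ⟦⟧-antitone ⊤ᶠ       _          = ≤-refl
      ⟦⟧-antitone ⊥ᶠ       _          = ≤-refl
      ⟦⟧-antitone (a ∧ᶠ b) (na , nb)  = ∧-monotonic (⟦⟧-antitone a na) (⟦⟧-antitone b nb)
      ⟦⟧-antitone (a ∨ᶠ b) (na , nb)  = ∨-monotonic (⟦⟧-antitone a na) (⟦⟧-antitone b nb)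
      ⟦⟧-antitone (a ⇒ b)  (pa , nb)  =
        transpose-⇨ (≤-trans (∧-monotonic ≤-refl (⟦⟧-monotone a pa))
                             (≤-trans (transpose-∧ ≤-refl) (⟦⟧-antitone b nb)))

  -- Polynomial maps preserve the congruence of the principal filter ↑ e.
  ⟦⟧-compatible : {V : Set} (t : Fm V) {e : Carrier} {ρ σ : V → Carrier} →
    (∀ v → e ∧ ρ v ≤ σ v) → (∀ v → e ∧ σ v ≤ ρ v) → e ∧ ⟦ t ⟧ ρ ≤ ⟦ t ⟧ σ
  ⟦⟧-compatible (var v)  ρ→σ σ→ρ = ρ→σ v
  ⟦⟧-compatible ⊤ᶠ       ρ→σ σ→ρ = maximum _
  ⟦⟧-compatible ⊥ᶠ       ρ→σ σ→ρ = x∧y≤y _ _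
  ⟦⟧-compatible (a ∧ᶠ b) {e} {ρ} ρ→σ σ→ρ = begin
    e ∧ (⟦ a ⟧ ρ ∧ ⟦ b ⟧ ρ)        ≤⟨ ∧-greatest (∧-monotonic ≤-refl (x∧y≤x _ _)) (∧-monotonic ≤-refl (x∧y≤y _ _)) ⟩
    (e ∧ ⟦ a ⟧ ρ) ∧ (e ∧ ⟦ b ⟧ ρ)  ≤⟨ ∧-monotonic (⟦⟧-compatible a ρ→σ σ→ρ) (⟦⟧-compatible b ρ→σ σ→ρ) ⟩
    _                              ∎
  ⟦⟧-compatible (a ∨ᶠ b) ρ→σ σ→ρ =
    ≤-trans (∧-distribˡ-∨-≤ _ _ _) (∨-monotonic (⟦⟧-compatible a ρ→σ σ→ρ) (⟦⟧-compatible b ρ→σ σ→ρ))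
  ⟦⟧-compatible (a ⇒ b) {e} {ρ} {σ} ρ→σ σ→ρ = transpose-⇨ (begin
    (e ∧ (⟦ a ⟧ ρ ⇨ ⟦ b ⟧ ρ)) ∧ ⟦ a ⟧ σ        ≤⟨ ∧-greatest (x∧y≤x _ _) (∧-monotonic (x∧y≤x _ _) ≤-refl) ⟩
    (e ∧ (⟦ a ⟧ ρ ⇨ ⟦ b ⟧ ρ)) ∧ (e ∧ ⟦ a ⟧ σ)  ≤⟨ ∧-monotonic ≤-refl (⟦⟧-compatible a σ→ρ ρ→σ) ⟩
    (e ∧ (⟦ a ⟧ ρ ⇨ ⟦ b ⟧ ρ)) ∧ ⟦ a ⟧ ρ        ≈⟨ ∧-assoc _ _ _ ⟩
    e ∧ ((⟦ a ⟧ ρ ⇨ ⟦ b ⟧ ρ) ∧ ⟦ a ⟧ ρ)        ≤⟨ ∧-monotonic ≤-refl ⇨-eval ⟩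
    e ∧ ⟦ b ⟧ ρ                                ≤⟨ ⟦⟧-compatible b ρ→σ σ→ρ ⟩
    ⟦ b ⟧ σ                                    ∎)

  IsLeastFixedPoint-resp-≗ : {f g : Carrier → Carrier} {a : Carrier} →
    (∀ x → f x ≡ g x) → IsLeastFixedPoint H f a → IsLeastFixedPoint H g a
  IsLeastFixedPoint-resp-≗ {a = a} f≗g (fa≈a , least) =
    ≡.subst (_≈ a) (f≗g a) fa≈a , λ b gb≈b → least b (≡.subst (_≈ b) (sym (f≗g b)) gb≈b)

  module AntitoneComposite
    {n : ℕ} (G : (Fin n → Carrier) → Carrier) (h : Fin n → Carrier → Carrier)
    (G-antitone : ∀ {u v} → (∀ i → u i ≤ v i) → G v ≤ G u)
    (G-compatible : ∀ {e u v} → (∀ i → e ∧ u i ≤ v i) → (∀ i → e ∧ v i ≤ u i) → e ∧ G u ≤ G v)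
    (h-antitone : ∀ i {x y} → x ≤ y → h i y ≤ h i x)
    (h-compatible : ∀ i {e x y} → e ∧ x ≤ y → e ∧ y ≤ x → e ∧ h i x ≤ h i y)
    where

    f : Carrier → Carrier
    f x = G (λ i → h i x)

    approx : ℕ → Carrier
    approx zero    = ⊥
    approx (suc k) = f (approx k)

    inner : ℕ → Fin n → Carrier
    inner k i = h i (approx k)

    f-monotone : ∀ {x y} → x ≤ y → f x ≤ f y
    f-monotone x≤y = G-antitone (λ i → h-antitone i x≤y)

    approx-ascending : ∀ k → approx k ≤ approx (suc k)
    approx-ascending zero    = minimum _
    approx-ascending (suc k) = f-monotone (approx-ascending k)

    inner-descending : ∀ k i → inner (suc k) i ≤ inner k i
    inner-descending k i = h-antitone i (approx-ascending k)

    approx-below-fixed-points : ∀ {b} → f b ≈ b → ∀ k → approx k ≤ b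
    approx-below-fixed-points fb≈b zero    = minimum _
    approx-below-fixed-points fb≈b (suc k) =
      ≤-trans (f-monotone (approx-below-fixed-points fb≈b k)) (reflexive fb≈b)

    -- R holds the coordinates not yet known to be stable below e.  A coordinate
    -- i ∈ R is handled one stage earlier, below e ∧ inner k i where i itself is
    -- trivially settled; each recursion uses up an element of R and a stage.
    mutual
      approx-stable-below : ∀ k (R : Subset n) → ∣ R ∣ ≤ℕ k → ∀ e →
        (∀ i → i ∉ R → e ≤ inner (suc k) i) → e ∧ approx (suc (suc k)) ≤ approx (suc k)
      approx-stable-below k R ∣R∣≤k e settled =
        G-compatible (λ i → ≤-trans (x∧y≤y _ _) (inner-descending k i))
                     (inner-stable-below k R ∣R∣≤k e settled)

      inner-stable-below : ∀ k (R : Subset n) → ∣ R ∣ ≤ℕ k → ∀ e →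
        (∀ i → i ∉ R → e ≤ inner (suc k) i) → ∀ i → e ∧ inner k i ≤ inner (suc k) i
      inner-stable-below k R ∣R∣≤k e settled i with i ∈? R
      ... | no i∉R = ≤-trans (x∧y≤x _ _) (settled i i∉R)
      inner-stable-below zero    R ∣R∣≤0 e settled i | yes i∈R =
        contradiction (<-≤-trans (x∈p⇒∣p-x∣<∣p∣ i∈R) ∣R∣≤0) n≮0
      inner-stable-below (suc k) R ∣R∣≤k e settled i | yes i∈R =
        ≤-trans (∧-greatest ≤-refl (x∧y≤y _ _))
                (h-compatible i (≤-trans (x∧y≤y _ _) (approx-ascending (suc k)))
                                (approx-stable-below k (R - i) ∣R-i∣≤k e′ settled′))
        where
        e′ : Carrier
        e′ = e ∧ inner (suc k) i

        ∣R-i∣≤k : ∣ R - i ∣ ≤ℕ k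
        ∣R-i∣≤k = ≤-pred (<-≤-trans (x∈p⇒∣p-x∣<∣p∣ i∈R) ∣R∣≤k)

        settled′ : ∀ j → j ∉ R - i → e′ ≤ inner (suc k) j
        settled′ j j∉R-i with j ≟ i
        ... | yes refl = x∧y≤y _ _
        ... | no j≢i   = ≤-trans (x∧y≤x _ _)
          (≤-trans (settled j (λ j∈R → j∉R-i (x∈p∧x≢y⇒x∈p-y j∈R j≢i))) (inner-descending (suc k) j))

    approx-fixed : f (approx (suc n)) ≤ approx (suc n)
    approx-fixed =
      ≤-trans (∧-greatest (maximum _) ≤-refl)
              (approx-stable-below n Subset.⊤ (≤-reflexive (∣⊤∣≡n n)) ⊤ (λ i i∉⊤ → ⊥-elim (i∉⊤ ∈⊤)))

    approx-least-fixed-point : IsLeastFixedPoint H f (approx (suc n))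
    approx-least-fixed-point =
      antisym approx-fixed (approx-ascending (suc n)) , λ b fb≈b → approx-below-fixed-points fb≈b (suc n)

  module Decomposition {P : Set} {n : ℕ} (ψ₀ : Fm (Fin n ⊎ P)) (ψ : Fin n → Fm (Maybe P))
    (ρ : P → Carrier) (ψ₀-antitone-in-y : AllNeg IsY ψ₀) (ψ-antitone-in-x : ∀ i → AllNeg IsX (ψ i))
    where

    G : (Fin n → Carrier) → Carrier
    G u = ⟦ ψ₀ ⟧ [ u , ρ ]′

    h : Fin n → Carrier → Carrier
    h i x = ⟦ ψ i ⟧ (maybe′ ρ x)

    G-antitone : ∀ {u v} → (∀ i → u i ≤ v i) → G v ≤ G u
    G-antitone {u} {v} u≤v = ⟦⟧-antitone IsY u≤v′ v≤u-off-y ψ₀ ψ₀-antitone-in-y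
      where
      u≤v′ : ∀ w → [ u , ρ ]′ w ≤ [ v , ρ ]′ w
      u≤v′ (inj₁ i) = u≤v i
      u≤v′ (inj₂ p) = ≤-refl
      v≤u-off-y : ∀ w → ¬ IsY w → [ v , ρ ]′ w ≤ [ u , ρ ]′ w
      v≤u-off-y (inj₁ i) ¬y = ⊥-elim (¬y (i , refl))
      v≤u-off-y (inj₂ p) ¬y = ≤-refl

    G-compatible : ∀ {e u v} → (∀ i → e ∧ u i ≤ v i) → (∀ i → e ∧ v i ≤ u i) → e ∧ G u ≤ G v
    G-compatible {e} {u} {v} u→v v→u = ⟦⟧-compatible ψ₀ (lift u→v) (lift v→u)
      where
      lift : ∀ {u v} → (∀ i → e ∧ u i ≤ v i) → ∀ w → e ∧ [ u , ρ ]′ w ≤ [ v , ρ ]′ w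
      lift u→v (inj₁ i) = u→v i
      lift u→v (inj₂ p) = x∧y≤y _ _

    h-antitone : ∀ i {x y} → x ≤ y → h i y ≤ h i x
    h-antitone i {x} {y} x≤y = ⟦⟧-antitone IsX x≤y′ y≤x-off-x (ψ i) (ψ-antitone-in-x i)
      where
      x≤y′ : ∀ w → maybe′ ρ x w ≤ maybe′ ρ y w
      x≤y′ nothing  = x≤y
      x≤y′ (just p) = ≤-refl
      y≤x-off-x : ∀ w → ¬ IsX w → maybe′ ρ y w ≤ maybe′ ρ x w
      y≤x-off-x nothing  ¬x = ⊥-elim (¬x refl)
      y≤x-off-x (just p) ¬x = ≤-refl

    h-compatible : ∀ i {e x y} → e ∧ x ≤ y → e ∧ y ≤ x → e ∧ h i x ≤ h i y
    h-compatible i {e} x→y y→x = ⟦⟧-compatible (ψ i) (lift x→y) (lift y→x)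
      where
      lift : ∀ {x y} → e ∧ x ≤ y → ∀ w → e ∧ maybe′ ρ x w ≤ maybe′ ρ y w
      lift x→y nothing  = x→y
      lift x→y (just p) = x∧y≤y _ _

    open AntitoneComposite G h G-antitone G-compatible h-antitone h-compatible

    fun-compose : ∀ x → fun H (compose ψ₀ ψ) ρ x ≡ f x
    fun-compose x = trans (fun-maybe′ (compose ψ₀ ψ) ρ x)
      (trans (⟦⟧-subst _ ψ₀ _) (⟦⟧-cong ψ₀ λ { (inj₁ i) → refl ; (inj₂ p) → refl }))

    iter-compose : ∀ k → iter H (compose ψ₀ ψ) ρ k ≡ approx k
    iter-compose zero    = refl
    iter-compose (suc k) = trans (fun-compose _) (cong f (iter-compose k))

    least-fixed-point : IsLeastFixedPoint H (fun H (compose ψ₀ ψ) ρ) (iter H (compose ψ₀ ψ) ρ (suc n))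
    least-fixed-point =
      ≡.subst (IsLeastFixedPoint H _) (sym (iter-compose (suc n)))
            (IsLeastFixedPoint-resp-≗ (λ x → sym (fun-compose x)) approx-least-fixed-point)

-- Positivity and weak negativity of φ are what make the decomposition exist.
proposition6p8 : {P : Set} (n : ℕ) (φ : Fm (Maybe P)) (ψ₀ : Fm (Fin n ⊎ P)) (ψ : Fin n → Fm (Maybe P)) →
    AllPos IsX φ → WeaklyNeg IsX φ →
    φ ≡ compose ψ₀ ψ → AllNeg IsY ψ₀ → (∀ i → AllNeg IsX (ψ i)) →
    ∀ {c ℓ₁ ℓ₂ : Level} (H : HeytingAlgebra c ℓ₁ ℓ₂) (ρ : P → HeytingAlgebra.Carrier H) →
    IsLeastFixedPoint H (fun H φ ρ) (iter H φ ρ (n + 1))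
proposition6p8 n φ ψ₀ ψ _ _ refl ψ₀-neg ψ-neg H ρ rewrite +-comm n 1 =
  Decomposition.least-fixed-point H ψ₀ ψ ρ ψ₀-neg ψ-neg
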